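{- Let $T_0$ be a theory and let $T$ be the smallest closed theory which contains $T_0$, $\mathbf{V}$ and $\mathbf{K}$ and which has the property that $\varphi\in T$ whenever $T\models\varphi$. If $T_0$ is generic then $T$ is generic; and if $T_0$ is closed generic then $T$ is closed generic.
   Context: Fix a nonempty set of symbols called propositional atoms and a symbol $\mathrm{K}$ which is not a propositional atom. Formulas are defined recursively: every propositional atom is a formula; if $\varphi,\psi$ are formulas then so are $\neg\varphi$, $(\varphi\wedge\psi)$, $(\varphi\vee\psi)$, $(\varphi\rightarrow\psi)$; if $\varphi$ is a formula then so is $\mathrm{K}(\varphi)$. A formula is basic if it is a propositional atom or of the form $\mathrm{K}\varphi$. A theory is a set of formulas. A model is a function assigning a truth value to every basic formula; truth $\mathscr M\models\varphi$ of an arbitrary formula is defined from the values of basic formulas by the classical truth tables (formulas $\mathrm{K}\varphi$ are treated like atoms). $\mathscr M\models T$ means $\mathscr M\models\varphi$ for all $\varphi\in T$; $T\models\varphi$ means every model of $T$ satisfies $\varphi$; $\varphi$ is valid if $\emptyset\models\varphi$. A theory $T$ is closed if $\varphi\in T$ implies $\mathrm{K}\varphi\in T$. $\mathbf{V}=\{\mathrm{K}\varphi:\varphi\text{ valid}\}$; $\mathbf{K}=\{\mathrm{K}(\varphi\rightarrow\psi)\rightarrow(\mathrm{K}\varphi\rightarrow\mathrm{K}\psi)\}$ (all formulas of this form). For a theory $T$ and a set $S$ of propositional atoms, $\mathscr M_{T,S}$ is the model with $\mathscr M_{T,S}\models p$ iff $p\in S$ for atoms $p$, and $\mathscr M_{T,S}\models\mathrm{K}\varphi$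 iff $T\models\varphi$. A theory $T$ is generic if for every set $S$ of propositional atoms and every theory $T'\supseteq T$, $\mathscr M_{T',S}\models T$; $T$ is closed generic if for every set $S$ of propositional atoms and every closed theory $T'\supseteq T$, $\mathscr M_{T',S}\models T$. -}

module Defs where

open import Data.Bool using (Bool; true; false; not; _∧_; _∨_)
open import Data.Product using (Σ; _×_; _,_)
open import Relation.Binary.PropositionalEquality using (_≡_)
open import Function.Bundles using (_⇔_)

data Formula (A : Set) : Set where
  atom : A → Formula A
  ¬'_  : Formula A → Formula A
  _∧'_ : Formula A → Formula A → Formula A
  _∨'_ : Formula A → Formula A → Formula A
  _⇒'_ : Formula A → Formula A → Formula A
  K    : Formula A → Formula A

data Basic (A : Set) : Set where
  batom : A → Basic A
  bK    : Formula A → Basic A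

Model : Set → Set
Model A = Basic A → Bool

⟦_⟧ : {A : Set} → Formula A → Model A → Bool
⟦ atom p ⟧ M = M (batom p)
⟦ ¬' φ ⟧ M = not (⟦ φ ⟧ M)
⟦ φ ∧' ψ ⟧ M = ⟦ φ ⟧ M ∧ ⟦ ψ ⟧ M
⟦ φ ∨' ψ ⟧ M = ⟦ φ ⟧ M ∨ ⟦ ψ ⟧ M
⟦ φ ⇒' ψ ⟧ M = not (⟦ φ ⟧ M) ∨ ⟦ ψ ⟧ M
⟦ K φ ⟧ M = M (bK φ)

_⊨_ : {A : Set} → Model A → Formula A → Set
M ⊨ φ = ⟦ φ ⟧ M ≡ true

Theory : Set → Set₁
Theory A = Formula A → Set

_⊆_ : {A : Set} → Theory A → Theory A → Set
T ⊆ T' = ∀ φ → T φ → T' φ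

_⊨T_ : {A : Set} → Model A → Theory A → Set
M ⊨T T = ∀ φ → T φ → M ⊨ φ

_⊩_ : {A : Set} → Theory A → Formula A → Set
T ⊩ φ = ∀ M → M ⊨T T → M ⊨ φ

Valid : {A : Set} → Formula A → Set
Valid φ = ∀ M → M ⊨ φ

Closed : {A : Set} → Theory A → Set
Closed T = ∀ φ → T φ → T (K φ)

ContainsV : {A : Set} → Theory A → Set
ContainsV T = ∀ φ → Valid φ → T (K φ)

ContainsK : {A : Set} → Theory A → Set
ContainsK T = ∀ φ ψ → T (K (φ ⇒' ψ) ⇒' (K φ ⇒' K ψ))

DeductivelyClosed : {A : Set} → Theory A → Set
DeductivelyClosed T = ∀ φ → T ⊩ φ → T φ

Admissible : {A : Set} → Theory A → Theory A → Set
Admissible T₀ T = Closed T × (T₀ ⊆ T) × ContainsV T × ContainsK T × DeductivelyClosed T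

IsSmallest : {A : Set} → Theory A → Theory A → Set₁
IsSmallest T₀ T = Admissible T₀ T × (∀ T' → Admissible T₀ T' → T ⊆ T')

-- M is the model 𝓜_{T,S}: atoms p true iff p ∈ S (S as a Bool-valued
-- characteristic function), K φ true iff T ⊨ φ.
IsM : {A : Set} → Theory A → (A → Bool) → Model A → Set
IsM T S M = (∀ p → M (batom p) ≡ S p) × (∀ φ → (M (bK φ) ≡ true) ⇔ (T ⊩ φ))

Generic : {A : Set} → Theory A → Set₁
Generic T = ∀ (S : _ → Bool) (T' : Theory _) → T ⊆ T' → ∀ M → IsM T' S M → M ⊨T T

ClosedGeneric : {A : Set} → Theory A → Set₁
ClosedGeneric T = ∀ (S : _ → Bool) (T' : Theory _) → T ⊆ T' → Closed T' → ∀ M → IsM T' S M → M ⊨T T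

{-# OPTIONS --safe #-}
module Submission where

open import Defs
open import Data.Bool using (Bool; true; false)
open import Data.Product using (_×_; _,_; proj₁; proj₂)
open import Function using (_∘_)
open import Function.Bundles using (Equivalence)
open import Relation.Binary.PropositionalEquality using (refl)

-- Let M = 𝓜_{T',S} with T ⊆ T', and suppose M ⊨ T₀. The formulas of T that
-- are true in M form an admissible theory: M validates every K-axiom because
-- T' ⊩ is closed under modus ponens, every Kφ with φ valid or φ ∈ T because
-- T' ⊩ φ, and truth in a single model is deductively closed. Minimality of T
-- then gives M ⊨ T, which is all that genericity asks.

module _ {A : Set} where

  ⇒-elim : (M : Model A) (φ ψ : Formula A) → M ⊨ (φ ⇒' ψ) → M ⊨ φ → M ⊨ ψ
  ⇒-elim M φ ψ M⊨φ⇒ψ M⊨φ with ⟦ φ ⟧ M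
  ⇒-elim M φ ψ M⊨φ⇒ψ refl | true = M⊨φ⇒ψ

  ⇒-intro : (M : Model A) (φ ψ : Formula A) → (M ⊨ φ → M ⊨ ψ) → M ⊨ (φ ⇒' ψ)
  ⇒-intro M φ ψ M⊨φ→ψ with ⟦ φ ⟧ M
  ... | true  = M⊨φ→ψ refl
  ... | false = refl

  ⊩-mp : {T : Theory A} (φ ψ : Formula A) → T ⊩ (φ ⇒' ψ) → T ⊩ φ → T ⊩ ψ
  ⊩-mp φ ψ T⊩φ⇒ψ T⊩φ M M⊨T = ⇒-elim M φ ψ (T⊩φ⇒ψ M M⊨T) (T⊩φ M M⊨T)

  ⊆⇒⊩ : {T T' : Theory A} {φ : Formula A} → T ⊆ T' → T φ → T' ⊩ φ
  ⊆⇒⊩ T⊆T' Tφ M M⊨T' = M⊨T' _ (T⊆T' _ Tφ)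

  _∩⊨_ : Theory A → Model A → Theory A
  (T ∩⊨ M) φ = T φ × (M ⊨ φ)

  ∩⊨-admissible : {T₀ T : Theory A} {M : Model A} → Admissible T₀ T → M ⊨T T₀ →
                  (∀ φ → Valid φ → M ⊨ K φ) →
                  (∀ φ ψ → M ⊨ (K (φ ⇒' ψ) ⇒' (K φ ⇒' K ψ))) →
                  (∀ φ → T φ → M ⊨ K φ) →
                  Admissible T₀ (T ∩⊨ M)
  ∩⊨-admissible {M = M} (cl , T₀⊆T , cV , cK , dc) M⊨T₀ M⊨V M⊨K M⊨KT =
      (λ φ (Tφ , _) → cl φ Tφ , M⊨KT φ Tφ)
    , (λ φ T₀φ → T₀⊆T φ T₀φ , M⊨T₀ φ T₀φ)
    , (λ φ valid → cV φ valid , M⊨V φ valid)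
    , (λ φ ψ → cK φ ψ , M⊨K φ ψ)
    , λ φ T∩M⊩φ → dc φ (λ N N⊨T → T∩M⊩φ N (λ ψ → N⊨T ψ ∘ proj₁))
                 , T∩M⊩φ M (λ ψ → proj₂)

  smallest-⊨ : {T₀ T : Theory A} {M : Model A} → IsSmallest T₀ T → M ⊨T T₀ →
               (∀ φ → Valid φ → M ⊨ K φ) →
               (∀ φ ψ → M ⊨ (K (φ ⇒' ψ) ⇒' (K φ ⇒' K ψ))) →
               (∀ φ → T φ → M ⊨ K φ) →
               M ⊨T T
  smallest-⊨ {T = T} {M} (adm , least) M⊨T₀ M⊨V M⊨K M⊨KT φ Tφ =
    proj₂ (least (T ∩⊨ M) (∩⊨-admissible adm M⊨T₀ M⊨V M⊨K M⊨KT) φ Tφ)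

  module _ {T' : Theory A} {S : A → Bool} {M : Model A} (isM : IsM T' S M) where

    K-intro : (φ : Formula A) → T' ⊩ φ → M ⊨ K φ
    K-intro φ = Equivalence.from (proj₂ isM φ)

    K-elim : (φ : Formula A) → M ⊨ K φ → T' ⊩ φ
    K-elim φ = Equivalence.to (proj₂ isM φ)

    IsM-⊨-V : ∀ φ → Valid φ → M ⊨ K φ
    IsM-⊨-V φ valid = K-intro φ (λ N _ → valid N)

    IsM-⊨-K : ∀ φ ψ → M ⊨ (K (φ ⇒' ψ) ⇒' (K φ ⇒' K ψ))
    IsM-⊨-K φ ψ =
      ⇒-intro M (K (φ ⇒' ψ)) (K φ ⇒' K ψ) λ M⊨Kφ⇒ψ →
      ⇒-intro M (K φ) (K ψ) λ M⊨Kφ →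
      K-intro ψ (⊩-mp φ ψ (K-elim (φ ⇒' ψ) M⊨Kφ⇒ψ) (K-elim φ M⊨Kφ))

    IsM-⊨-smallest : {T₀ T : Theory A} → IsSmallest T₀ T → T ⊆ T' → M ⊨T T₀ → M ⊨T T
    IsM-⊨-smallest smallest T⊆T' M⊨T₀ =
      smallest-⊨ smallest M⊨T₀ IsM-⊨-V IsM-⊨-K (λ φ Tφ → K-intro φ (⊆⇒⊩ T⊆T' Tφ))

theorem18 : {A : Set} → A → (T₀ T : Theory A) → IsSmallest T₀ T →
            (Generic T₀ → Generic T) × (ClosedGeneric T₀ → ClosedGeneric T)
theorem18 _ T₀ T smallest@((_ , T₀⊆T , _) , _) =
    (λ generic S T' T⊆T' M isM →
       IsM-⊨-smallest isM smallest T⊆T' (generic S T' (T₀⊆T' T⊆T') M isM))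
  , (λ generic S T' T⊆T' closed M isM →
       IsM-⊨-smallest isM smallest T⊆T' (generic S T' (T₀⊆T' T⊆T') closed M isM))
  where
  T₀⊆T' : {T' : Theory _} → T ⊆ T' → T₀ ⊆ T'
  T₀⊆T' T⊆T' φ T₀φ = T⊆T' φ (T₀⊆T φ T₀φ)
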